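{- If there exists a DTS$(v)$ having a $v$-good sequencing, then there exists a DTS$(2v+1)$ having a $(2v+1)$-good sequencing.
   Context: A transitive triple is an ordered triple $(x,y,z)$ of distinct elements; it contains the directed edges $(x,y)$, $(x,z)$, $(y,z)$. A directed triple system of order $v$, DTS$(v)$, is a pair $(X,\mathcal{B})$ where $X$ is a set of $v$ points and $\mathcal{B}$ is a set of transitive triples of elements of $X$ such that every ordered pair $(a,b)$ of distinct points of $X$ occurs as a directed edge in exactly one triple of $\mathcal{B}$. A $v$-good sequencing of a DTS$(v)$ $(X,\mathcal{B})$ is a permutation $[x_1\, x_2\, \cdots\, x_v]$ of $X$ such that for no triple $(x,y,z)\in\mathcal{B}$ do we have $x=x_i$, $y=x_j$, $z=x_k$ with $i<j<k$. -}

module Defs where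

open import Data.Nat using (ℕ)
open import Data.Fin using (Fin; _<_)
open import Data.Fin.Permutation using (Permutation′; _⟨$⟩ʳ_)
open import Data.List using (List; length; lookup)
open import Data.Product using (_×_; _,_; Σ; ∃)
open import Relation.Binary.PropositionalEquality using (_≡_; _≢_)
open import Relation.Nullary using (¬_)

-- A transitive triple (x , y , z) on point set Fin v.
Triple : ℕ → Set
Triple v = Fin v × Fin v × Fin v

Distinct : ∀ {v} → Triple v → Set
Distinct (x , y , z) = x ≢ y × x ≢ z × y ≢ z

data EdgeOf {v : ℕ} (a b : Fin v) : Triple v → Set where
  exy : ∀ {z} → EdgeOf a b (a , b , z)
  exz : ∀ {y} → EdgeOf a b (a , y , b)
  eyz : ∀ {x} → EdgeOf a b (x , a , b)

record IsDTS (v : ℕ) (B : List (Triple v)) : Set where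
  field
    distinct    : ∀ i → Distinct (lookup B i)
    exactlyOne  : ∀ (a b : Fin v) → a ≢ b →
                  Σ (Fin (length B)) λ i → EdgeOf a b (lookup B i) ×
                    (∀ j → EdgeOf a b (lookup B j) → j ≡ i)

-- A v-good sequencing [x_1 ... x_v]: a permutation σ of the points where
-- σ ⟨$⟩ʳ i is the point x_i in position i.  Good: no triple (x,y,z) in B
-- has x = x_i, y = x_j, z = x_k with i < j < k.
IsGoodSequencing : ∀ {v} → List (Triple v) → Permutation′ v → Set
IsGoodSequencing {v} B σ =
  ∀ (t : Fin (length B)) (i j k : Fin v) → i < j → j < k →
    ¬ (lookup B t ≡ (σ ⟨$⟩ʳ i , σ ⟨$⟩ʳ j , σ ⟨$⟩ʳ k))

HasGoodDTS : ℕ → Set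
HasGoodDTS v = ∃ λ (B : List (Triple v)) → IsDTS v B × ∃ λ σ → IsGoodSequencing B σ

-- The v + 1 new points form the cyclic group ℤ_{v+1}, and the old points x₁, …, x_v act on it
-- as the nonzero translations c ↦ c + i.  Keep the old triples and add, for every old point x_i
-- and every new point c, the triple (c, x_i, c + i).  An ordered pair (x_i, d) of an old and a
-- new point lies only in the new triple with c = d − i, a pair (c, x_i) only in the one with
-- this c and i, and a pair (c, d) of distinct new points only in the one with i = d − c ≠ 0;
-- pairs of old points are covered by the old triples alone.  Sequence the old points by their
-- good sequencing and put the new points after them: every new triple then starts with a new
-- point that comes later than its old middle point, so it is never sequenced in increasing order.
module Submission where

open import Defs
open import Data.Nat as ℕ using (ℕ; suc; _+_; _*_; _%_; NonZero)
open import Data.Nat.DivMod using (_mod_; [m+kn]%n≡m%n; %-distribˡ-+; m<n⇒m%n≡m)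
open import Data.Nat.Properties
  using (+-comm; +-identityʳ; 1+n≰n; 1+n≢0; suc-injective; <⇒≱; <⇒≤; ≤-trans; m≤m+n)
open import Data.Nat.Tactic.RingSolver using (solve-∀)
open import Data.Fin using (Fin; toℕ; punchOut; cast; _<_; _↑ˡ_; _↑ʳ_)
open import Data.Fin.Properties
  using (toℕ-fromℕ<; toℕ<n; toℕ-injective; any?; _≟_; injective⇒≤; punchOut-injective;
         cast-involutive; toℕ-↑ˡ; toℕ-↑ʳ; +↔⊎; *↔×)
open import Data.Fin.Permutation using (Permutation′; _⟨$⟩ʳ_; _⟨$⟩ˡ_; inverseˡ)
import Data.Fin.Permutation as Permutation
open import Data.List using (List; length; lookup; tabulate)
open import Data.List.Properties using (length-tabulate; lookup-tabulate)
open import Data.Product using (_×_; _,_; ∃; ∃!)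
open import Data.Sum using (_⊎_; inj₁; inj₂)
open import Data.Sum.Properties using (inj₁-injective; inj₂-injective)
open import Data.Sum.Function.Propositional using (_⊎-↔_)
open import Function using (_∘_; Injective)
open import Function.Bundles using (_↔_; Inverse; Injection; mk↔ₛ′)
open import Function.Properties.Inverse using (↔-refl; ↔-sym; ↔-trans; ↔⇒↣)
open import Relation.Binary.PropositionalEquality
  using (_≡_; _≢_; refl; sym; trans; cong; cong₂; subst; subst₂; module ≡-Reasoning)
open import Relation.Nullary using (¬_; yes; no; contradiction)

private variable
  A B P Q I J : Set
  m n k : ℕ

n+m*[1+k]≡m+n+m*k : ∀ m n k → n + m * suc k ≡ m + n + m * k
n+m*[1+k]≡m+n+m*k = solve-∀

-- Adding m * (d ∸ 1) undoes adding m, because m + m * (d ∸ 1) = m * d is divisible by d.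
[m+n]%d≡[m+o]%d⇒n%d≡o%d : ∀ m n o {d} .{{_ : NonZero d}} →
                           (m + n) % d ≡ (m + o) % d → n % d ≡ o % d
[m+n]%d≡[m+o]%d⇒n%d≡o%d m n o {d@(suc d-1)} eq = begin
  n % d                            ≡⟨ undo n ⟩
  ((m + n) % d + m * d-1 % d) % d  ≡⟨ cong (λ r → (r + m * d-1 % d) % d) eq ⟩
  ((m + o) % d + m * d-1 % d) % d  ≡⟨ undo o ⟨
  o % d                            ∎
  where
  open ≡-Reasoning
  undo : ∀ n → n % d ≡ ((m + n) % d + m * d-1 % d) % d
  undo n = begin
    n % d                            ≡⟨ [m+kn]%n≡m%n n m d ⟨
    (n + m * d) % d                  ≡⟨ cong (_% d) (n+m*[1+k]≡m+n+m*k m n d-1) ⟩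
    (m + n + m * d-1) % d            ≡⟨ %-distribˡ-+ (m + n) (m * d-1) d ⟩
    ((m + n) % d + m * d-1 % d) % d  ∎

+-cancelˡ-%-< : ∀ m {n o d} .{{_ : NonZero d}} → n ℕ.< d → o ℕ.< d →
                (m + n) % d ≡ (m + o) % d → n ≡ o
+-cancelˡ-%-< m {n} {o} n<d o<d eq = begin
  n      ≡⟨ m<n⇒m%n≡m n<d ⟨
  n % _  ≡⟨ [m+n]%d≡[m+o]%d⇒n%d≡o%d m n o eq ⟩
  o % _  ≡⟨ m<n⇒m%n≡m o<d ⟩
  o      ∎
  where open ≡-Reasoning

injective⇒surjective : ∀ {f : Fin n → Fin n} → Injective _≡_ _≡_ f → ∀ y → ∃ λ x → f x ≡ y
injective⇒surjective {suc n} {f} f-injective y with any? (λ x → f x ≟ y)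
... | yes hit = hit
... | no miss = contradiction (injective⇒≤ punchOut∘f-injective) 1+n≰n
  where
  y≢f : ∀ x → y ≢ f x
  y≢f x = miss ∘ (x ,_) ∘ sym
  punchOut∘f-injective : Injective _≡_ _≡_ (λ x → punchOut (y≢f x))
  punchOut∘f-injective = f-injective ∘ punchOut-injective (y≢f _) (y≢f _)

↑ˡ-cancel-< : ∀ n {i j : Fin m} → i ↑ˡ n < j ↑ˡ n → i < j
↑ˡ-cancel-< n {i} {j} = subst₂ ℕ._<_ (toℕ-↑ˡ i n) (toℕ-↑ˡ j n)

↑ʳ≮↑ˡ : ∀ (i : Fin m) (j : Fin n) → ¬ m ↑ʳ j < i ↑ˡ n
↑ʳ≮↑ˡ {m} {n} i j lt = <⇒≱ (toℕ<n i)
  (≤-trans (m≤m+n m (toℕ j)) (<⇒≤ (subst₂ ℕ._<_ (toℕ-↑ʳ m j) (toℕ-↑ˡ i n) lt)))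

module _ {v : ℕ} where

  shift : Fin v → Fin (suc v) → Fin (suc v)
  shift x c = (toℕ c + suc (toℕ x)) mod suc v

  toℕ-shift : ∀ x c → toℕ (shift x c) ≡ (toℕ c + suc (toℕ x)) % suc v
  toℕ-shift x c = toℕ-fromℕ< _

  shift-≡⇒%-≡ : ∀ {x x′ c c′} → shift x c ≡ shift x′ c′ →
                (toℕ c + suc (toℕ x)) % suc v ≡ (toℕ c′ + suc (toℕ x′)) % suc v
  shift-≡⇒%-≡ {x} {x′} {c} {c′} eq =
    trans (sym (toℕ-shift x c)) (trans (cong toℕ eq) (toℕ-shift x′ c′))

  shift-injectiveˡ : ∀ c → Injective _≡_ _≡_ (λ x → shift x c)
  shift-injectiveˡ c {x} {x′} eq = toℕ-injective (suc-injective
    (+-cancelˡ-%-< (toℕ c) (ℕ.s≤s (toℕ<n x)) (ℕ.s≤s (toℕ<n x′)) (shift-≡⇒%-≡ {x} {x′} {c} {c} eq)))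

  shift-injectiveʳ : ∀ x → Injective _≡_ _≡_ (shift x)
  shift-injectiveʳ x {c} {c′} eq = toℕ-injective
    (+-cancelˡ-%-< (suc (toℕ x)) (toℕ<n c) (toℕ<n c′)
      (subst₂ (λ r s → r % suc v ≡ s % suc v) (+-comm (toℕ c) _) (+-comm (toℕ c′) _)
        (shift-≡⇒%-≡ {x} {x} {c} {c′} eq)))

  shift-≢ : ∀ x c → shift x c ≢ c
  shift-≢ x c eq = 1+n≢0 (+-cancelˡ-%-< (toℕ c) (ℕ.s≤s (toℕ<n x)) ℕ.z<s residues)
    where
    open ≡-Reasoning
    residues : (toℕ c + suc (toℕ x)) % suc v ≡ (toℕ c + 0) % suc v
    residues = begin
      (toℕ c + suc (toℕ x)) % suc v  ≡⟨ toℕ-shift x c ⟨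
      toℕ (shift x c)                ≡⟨ cong toℕ eq ⟩
      toℕ c                          ≡⟨ m<n⇒m%n≡m (toℕ<n c) ⟨
      toℕ c % suc v                  ≡⟨ cong (_% suc v) (+-identityʳ (toℕ c)) ⟨
      (toℕ c + 0) % suc v            ∎

  shift-surjective : ∀ x d → ∃ λ c → shift x c ≡ d
  shift-surjective x = injective⇒surjective (shift-injectiveʳ x)

  -- x ↦ shift x c is an injection of Fin v into the v points other than c, hence onto them.
  shift-connects : ∀ {c d} → c ≢ d → ∃ λ x → shift x c ≡ d
  shift-connects {c} {d} c≢d =
    let x , eq = injective⇒surjective punchOut∘shift-injective (punchOut c≢d)
    in  x , punchOut-injective (c≢shift x) c≢d eq
    where
    c≢shift : ∀ x → c ≢ shift x c
    c≢shift x = shift-≢ x c ∘ sym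
    punchOut∘shift-injective : Injective _≡_ _≡_ (λ x → punchOut (c≢shift x))
    punchOut∘shift-injective = shift-injectiveˡ c ∘ punchOut-injective (c≢shift _) (c≢shift _)

infix 10 _³
_³ : Set → Set
A ³ = A × A × A

map³ : (A → B) → A ³ → B ³
map³ f (x , y , z) = f x , f y , f z

map³-strictlyInverseʳ : ∀ (p : A ↔ B) t → map³ (Inverse.from p) (map³ (Inverse.to p) t) ≡ t
map³-strictlyInverseʳ p (x , y , z) =
  cong₂ _,_ (strictlyInverseʳ x) (cong₂ _,_ (strictlyInverseʳ y) (strictlyInverseʳ z))
  where open Inverse p

data Edge {A : Set} (a b : A) : A ³ → Set where
  exy : ∀ {z} → Edge a b (a , b , z)
  exz : ∀ {y} → Edge a b (a , y , b)
  eyz : ∀ {x} → Edge a b (x , a , b)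

Edge-map : ∀ (f : A → B) {a b t} → Edge a b t → Edge (f a) (f b) (map³ f t)
Edge-map f exy = exy
Edge-map f exz = exz
Edge-map f eyz = eyz

Edge-unmap : ∀ (p : A ↔ B) {a b t} → Edge a b (map³ (Inverse.to p) t) →
             Edge (Inverse.from p a) (Inverse.from p b) t
Edge-unmap p e = subst (Edge _ _) (map³-strictlyInverseʳ p _) (Edge-map (Inverse.from p) e)

Edge-inj₁⁻¹ : ∀ {a b : A} t → Edge (inj₁ {B = B} a) (inj₁ b) (map³ inj₁ t) → Edge a b t
Edge-inj₁⁻¹ (x , y , z) exy = exy
Edge-inj₁⁻¹ (x , y , z) exz = exz
Edge-inj₁⁻¹ (x , y , z) eyz = eyz

Edge-map-ends : ∀ (f : A → B) {a b} t → Edge a b (map³ f t) →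
                (∃ λ x → f x ≡ a) × (∃ λ y → f y ≡ b)
Edge-map-ends f (x , y , z) exy = (x , refl) , (y , refl)
Edge-map-ends f (x , y , z) exz = (x , refl) , (z , refl)
Edge-map-ends f (x , y , z) eyz = (y , refl) , (z , refl)

Distinct³ : A ³ → Set
Distinct³ (x , y , z) = x ≢ y × x ≢ z × y ≢ z

Distinct³-map : ∀ {f : A → B} → Injective _≡_ _≡_ f → ∀ t → Distinct³ t → Distinct³ (map³ f t)
Distinct³-map f-injective (x , y , z) (x≢y , x≢z , y≢z) =
  x≢y ∘ f-injective , x≢z ∘ f-injective , y≢z ∘ f-injective

Increasing : (A → Fin n) → A ³ → Set
Increasing position (x , y , z) = position x < position y × position y < position z

Increasing-map : ∀ {f : A → B} {g : B → Fin m} {h : A → Fin n} →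
                 (∀ {x y} → g (f x) < g (f y) → h x < h y) →
                 ∀ t → Increasing g (map³ f t) → Increasing h t
Increasing-map reflects (x , y , z) (p , q) = reflects p , reflects q

-- A DTS on any point type P, its triples indexed by any type I, with a good sequencing given
-- by the position of each point (the inverse of the sequencing permutation).
record IsGoodDTS {P I : Set} (position : P → Fin n) (block : I → P ³) : Set where
  field
    distinct      : ∀ i → Distinct³ (block i)
    uniqueEdge    : ∀ {a b} → a ≢ b → ∃! _≡_ λ i → Edge a b (block i)
    notIncreasing : ∀ i → ¬ Increasing position (block i)

module _ {position : P → Fin n} {block : I → P ³} (G : IsGoodDTS position block) where
  open IsGoodDTS G
  open Inverse

  relabel : (p : P ↔ Q) {position′ : Q → Fin n} → (∀ x → position′ (to p x) ≡ position x) →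
            IsGoodDTS position′ (map³ (to p) ∘ block)
  relabel p {position′} position′∘p≗position = record
    { distinct      = λ i → Distinct³-map (Injection.injective (↔⇒↣ p)) (block i) (distinct i)
    ; uniqueEdge    = uniqueEdge′
    ; notIncreasing = λ i → notIncreasing i ∘ Increasing-map {f = to p} {g = position′}
                              (subst₂ _<_ (position′∘p≗position _) (position′∘p≗position _)) (block i)
    }
    where
    uniqueEdge′ : ∀ {a b} → a ≢ b → ∃! _≡_ λ i → Edge a b (map³ (to p) (block i))
    uniqueEdge′ {a} {b} a≢b =
      let i , e , unique = uniqueEdge (a≢b ∘ Injection.injective (↔⇒↣ (↔-sym p)))
      in  i , subst₂ (λ a b → Edge a b (map³ (to p) (block i)))
                     (strictlyInverseˡ p a) (strictlyInverseˡ p b) (Edge-map (to p) e)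
            , unique ∘ Edge-unmap p

  reindex : (r : I ↔ J) {block′ : J → P ³} → (∀ i → block′ (to r i) ≡ block i) →
            IsGoodDTS position block′
  reindex r {block′} block′∘r≗block = record
    { distinct      = λ j → subst Distinct³ (sym (block′≗block∘r⁻¹ j)) (distinct (from r j))
    ; uniqueEdge    = uniqueEdge′
    ; notIncreasing = λ j → notIncreasing (from r j) ∘ subst (Increasing position) (block′≗block∘r⁻¹ j)
    }
    where
    block′≗block∘r⁻¹ : ∀ j → block′ j ≡ block (from r j)
    block′≗block∘r⁻¹ j = trans (cong block′ (sym (strictlyInverseˡ r j))) (block′∘r≗block (from r j))
    uniqueEdge′ : ∀ {a b} → a ≢ b → ∃! _≡_ λ j → Edge a b (block′ j)
    uniqueEdge′ a≢b =
      let i , e , unique = uniqueEdge a≢b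
      in  to r i , subst (Edge _ _) (sym (block′∘r≗block i)) e
            , λ {j} e′ → trans (cong (to r) (unique (subst (Edge _ _) (block′≗block∘r⁻¹ j) e′)))
                               (strictlyInverseˡ r j)

Edge⇒EdgeOf : ∀ {a b : Fin n} {t} → Edge a b t → EdgeOf a b t
Edge⇒EdgeOf exy = exy
Edge⇒EdgeOf exz = exz
Edge⇒EdgeOf eyz = eyz

EdgeOf⇒Edge : ∀ {a b : Fin n} {t} → EdgeOf a b t → Edge a b t
EdgeOf⇒Edge exy = exy
EdgeOf⇒Edge exz = exz
EdgeOf⇒Edge eyz = eyz

Distinct⇒Distinct³ : ∀ (t : Triple n) → Distinct t → Distinct³ t
Distinct⇒Distinct³ (x , y , z) d = d

Distinct³⇒Distinct : ∀ (t : Triple n) → Distinct³ t → Distinct t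
Distinct³⇒Distinct (x , y , z) d = d

module _ {v} {B : List (Triple v)} {σ : Permutation′ v} where

  IsDTS×IsGoodSequencing⇒IsGoodDTS : IsDTS v B → IsGoodSequencing B σ → IsGoodDTS (σ ⟨$⟩ˡ_) (lookup B)
  IsDTS×IsGoodSequencing⇒IsGoodDTS isDTS good = record
    { distinct      = λ t → Distinct⇒Distinct³ (lookup B t) (distinct t)
    ; uniqueEdge    = λ a≢b → let t , e , unique = exactlyOne _ _ a≢b
                              in  t , EdgeOf⇒Edge e , λ {u} e′ → sym (unique u (Edge⇒EdgeOf e′))
    ; notIncreasing = λ t → notIncreasing (lookup B t) (good t)
    }
    where
    open IsDTS isDTS
    notIncreasing : ∀ s → (∀ i j k → i < j → j < k → s ≢ (σ ⟨$⟩ʳ i , σ ⟨$⟩ʳ j , σ ⟨$⟩ʳ k)) →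
                    ¬ Increasing (σ ⟨$⟩ˡ_) s
    notIncreasing s notSequenced (p , q) =
      notSequenced _ _ _ p q (sym (map³-strictlyInverseʳ (↔-sym σ) s))

  IsGoodDTS⇒IsDTS×IsGoodSequencing : IsGoodDTS (σ ⟨$⟩ˡ_) (lookup B) → IsDTS v B × IsGoodSequencing B σ
  IsGoodDTS⇒IsDTS×IsGoodSequencing G = isDTS , good
    where
    open IsGoodDTS G
    isDTS : IsDTS v B
    isDTS = record
      { distinct   = λ t → Distinct³⇒Distinct (lookup B t) (distinct t)
      ; exactlyOne = λ a b a≢b → let t , e , unique = uniqueEdge a≢b
                                 in  t , Edge⇒EdgeOf e , λ u e′ → sym (unique (EdgeOf⇒Edge e′))
      }
    σ⁻¹∘σ-mono-< : ∀ {i j} → i < j → σ ⟨$⟩ˡ (σ ⟨$⟩ʳ i) < σ ⟨$⟩ˡ (σ ⟨$⟩ʳ j)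
    σ⁻¹∘σ-mono-< = subst₂ _<_ (sym (inverseˡ σ)) (sym (inverseˡ σ))
    good : IsGoodSequencing B σ
    good t i j k i<j j<k eq =
      notIncreasing t (subst (Increasing (σ ⟨$⟩ˡ_)) (sym eq) (σ⁻¹∘σ-mono-< i<j , σ⁻¹∘σ-mono-< j<k))

IsGoodDTS⇒HasGoodDTS : {position : P → Fin n} {block : I → P ³} (p : P ↔ Fin n) (q : I ↔ Fin k) →
                       (∀ x → Inverse.to p x ≡ position x) → IsGoodDTS position block → HasGoodDTS n
IsGoodDTS⇒HasGoodDTS {n = n} {k = k} {block = block} p q p≗position G =
  let isDTS , good = IsGoodDTS⇒IsDTS×IsGoodSequencing {σ = Permutation.id}
                       (reindex (relabel G p p≗position) r lookup-triples)
  in  triples , isDTS , Permutation.id , good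
  where
  open Inverse
  family : Fin k → Triple n
  family = map³ (to p) ∘ block ∘ from q
  triples : List (Triple n)
  triples = tabulate family
  length≡k : length triples ≡ k
  length≡k = length-tabulate family
  r : _ ↔ Fin (length triples)
  r = ↔-trans q (mk↔ₛ′ (cast (sym length≡k)) (cast length≡k)
                       (cast-involutive (sym length≡k) length≡k) (cast-involutive length≡k (sym length≡k)))
  lookup-triples : ∀ i → lookup triples (to r i) ≡ map³ (to p) (block i)
  lookup-triples i =
    trans (lookup-tabulate family (to q i)) (cong (map³ (to p) ∘ block) (strictlyInverseʳ q i))

module Doubling {v} {J : Set} (position : Fin v → Fin v) (block : J → Triple v) where

  Point : Set
  Point = Fin v ⊎ Fin (suc v)

  Block : Set
  Block = J ⊎ (Fin v × Fin (suc v))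

  position₂ : Point → Fin (v + suc v)
  position₂ (inj₁ x) = position x ↑ˡ suc v
  position₂ (inj₂ c) = v ↑ʳ c

  block₂ : Block → Point ³
  block₂ (inj₁ j)       = map³ inj₁ (block j)
  block₂ (inj₂ (x , c)) = inj₂ c , inj₁ x , inj₂ (shift x c)

  module _ (G : IsGoodDTS position block) where
    open IsGoodDTS G

    uniqueEdge-old-old : ∀ {a b} → a ≢ b → ∃! _≡_ λ i → Edge (inj₁ a) (inj₁ b) (block₂ i)
    uniqueEdge-old-old a≢b =
      let j , e , unique = uniqueEdge a≢b
      in  inj₁ j , Edge-map inj₁ e
            , λ { {inj₁ j′} e′ → cong inj₁ (unique (Edge-inj₁⁻¹ (block j′) e′)) ; {inj₂ _} () }

    uniqueEdge-old-new : ∀ x d → ∃! _≡_ λ i → Edge (inj₁ x) (inj₂ d) (block₂ i)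
    uniqueEdge-old-new x d =
      let c , shift≡d = shift-surjective x d
      in  inj₂ (x , c) , subst (λ d → Edge (inj₁ x) (inj₂ d) (block₂ (inj₂ (x , c)))) shift≡d eyz
            , unique shift≡d
      where
      unique : ∀ {x c d i} → shift x c ≡ d → Edge (inj₁ x) (inj₂ d) (block₂ i) → inj₂ (x , c) ≡ i
      unique {i = inj₁ j} _ e′ with _ , (_ , ()) ← Edge-map-ends inj₁ (block j) e′
      unique {x} {i = inj₂ _} shift≡ eyz = cong (λ c → inj₂ (x , c)) (shift-injectiveʳ x shift≡)

    uniqueEdge-new-old : ∀ c x → ∃! _≡_ λ i → Edge (inj₂ c) (inj₁ x) (block₂ i)
    uniqueEdge-new-old c x = inj₂ (x , c) , exy , unique
      where
      unique : ∀ {c x i} → Edge (inj₂ c) (inj₁ x) (block₂ i) → inj₂ (x , c) ≡ i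
      unique {i = inj₁ j} e′ with (_ , ()) , _ ← Edge-map-ends inj₁ (block j) e′
      unique {i = inj₂ _} exy = refl

    uniqueEdge-new-new : ∀ {c d} → c ≢ d → ∃! _≡_ λ i → Edge (inj₂ c) (inj₂ d) (block₂ i)
    uniqueEdge-new-new {c} c≢d =
      let x , shift≡d = shift-connects c≢d
      in  inj₂ (x , c) , subst (λ d → Edge (inj₂ c) (inj₂ d) (block₂ (inj₂ (x , c)))) shift≡d exz
            , unique shift≡d
      where
      unique : ∀ {x c d i} → shift x c ≡ d → Edge (inj₂ c) (inj₂ d) (block₂ i) → inj₂ (x , c) ≡ i
      unique {i = inj₁ j} _ e′ with (_ , ()) , _ ← Edge-map-ends inj₁ (block j) e′
      unique {c = c} {i = inj₂ _} shift≡ exz = cong (λ x → inj₂ (x , c)) (shift-injectiveˡ c shift≡)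

    isGoodDTS : IsGoodDTS position₂ block₂
    isGoodDTS = record
      { distinct      = distinct₂
      ; uniqueEdge    = uniqueEdge₂
      ; notIncreasing = notIncreasing₂
      }
      where
      distinct₂ : ∀ i → Distinct³ (block₂ i)
      distinct₂ (inj₁ j)       = Distinct³-map inj₁-injective (block j) (distinct j)
      distinct₂ (inj₂ (x , c)) = (λ ()) , shift-≢ x c ∘ sym ∘ inj₂-injective , (λ ())

      uniqueEdge₂ : ∀ {a b} → a ≢ b → ∃! _≡_ λ i → Edge a b (block₂ i)
      uniqueEdge₂ {inj₁ a} {inj₁ b} a≢b = uniqueEdge-old-old (a≢b ∘ cong inj₁)
      uniqueEdge₂ {inj₁ x} {inj₂ d} _   = uniqueEdge-old-new x d
      uniqueEdge₂ {inj₂ c} {inj₁ x} _   = uniqueEdge-new-old c x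
      uniqueEdge₂ {inj₂ c} {inj₂ d} c≢d = uniqueEdge-new-new (c≢d ∘ cong inj₂)

      notIncreasing₂ : ∀ i → ¬ Increasing position₂ (block₂ i)
      notIncreasing₂ (inj₁ j) =
        notIncreasing j ∘ Increasing-map {f = inj₁} {g = position₂} (↑ˡ-cancel-< (suc v)) (block j)
      notIncreasing₂ (inj₂ (x , c)) (c<x , _) = ↑ʳ≮↑ˡ (position x) c c<x

v+[1+v]≡1+2*v : ∀ v → v + suc v ≡ suc (2 * v)
v+[1+v]≡1+2*v = solve-∀

lemma2p3 : (v : ℕ) → HasGoodDTS v → HasGoodDTS (suc (2 * v))
lemma2p3 v (B , isDTS , σ , good) =
  subst HasGoodDTS (v+[1+v]≡1+2*v v)
    (IsGoodDTS⇒HasGoodDTS points blocks points≗position₂ (isGoodDTS old))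
  where
  open Doubling (σ ⟨$⟩ˡ_) (lookup B)
  old : IsGoodDTS (σ ⟨$⟩ˡ_) (lookup B)
  old = IsDTS×IsGoodSequencing⇒IsGoodDTS {σ = σ} isDTS good
  points : Point ↔ Fin (v + suc v)
  points = ↔-trans (↔-sym σ ⊎-↔ ↔-refl) (↔-sym +↔⊎)
  points≗position₂ : ∀ x → Inverse.to points x ≡ position₂ x
  points≗position₂ (inj₁ _) = refl
  points≗position₂ (inj₂ _) = refl
  blocks : Block ↔ Fin (length B + v * suc v)
  blocks = ↔-trans (↔-refl ⊎-↔ ↔-sym *↔×) (↔-sym +↔⊎)
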